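{- Let $(X,+)$ be an abelian group, $\mathcal{A}$ a Sidon set in $X$, and $x,y\in X$ distinct with $x+y\notin\mathcal{A}$ and $T(x+y)\neq\emptyset$. Then each of the following three conditions is satisfied by at most one tuple $(a_1,a_2,a_3)\in T(x+y)$: (1) $x=a_1-x$; (2) $y=a_3-y$; (3) $a_1-x=a_3-y$.
   Context: A nonempty subset $\mathcal{A}$ of an abelian group $X$ is a Sidon set if $a+b=c+d$ with $a,b,c,d\in\mathcal{A}$ implies $\{a,b\}=\{c,d\}$. For $z\in X\setminus\mathcal{A}$, $T(z):=\{(a_1,a_2,a_3)\in\mathcal{A}^3: z=a_1-a_2+a_3\}$. -}

module Defs where

open import Level using (Level; _⊔_)
open import Algebra.Bundles using (AbelianGroup)
open import Data.Product using (Σ; ∃; _×_; _,_)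
open import Data.Sum using (_⊎_)
open import Relation.Unary using (Pred)

module _ {c ℓ : Level} (G : AbelianGroup c ℓ) where
  open AbelianGroup G renaming (Carrier to X; _∙_ to _+_; _⁻¹ to -_)

  _−_ : X → X → X
  a − b = a + (- b)

  IsSidon : {p : Level} → Pred X p → Set (c ⊔ ℓ ⊔ p)
  IsSidon 𝒜 =
    (∃ λ a → 𝒜 a) ×
    (∀ {a b c' d} → 𝒜 a → 𝒜 b → 𝒜 c' → 𝒜 d → (a + b) ≈ (c' + d) →
       ((a ≈ c') × (b ≈ d)) ⊎ ((a ≈ d) × (b ≈ c')))

  Triple : Set c
  Triple = X × X × X

  _≈₃_ : Triple → Triple → Set ℓ
  (a₁ , a₂ , a₃) ≈₃ (b₁ , b₂ , b₃) = (a₁ ≈ b₁) × (a₂ ≈ b₂) × (a₃ ≈ b₃)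

  -- membership in T(z) = {(a₁,a₂,a₃) ∈ 𝒜³ : z = a₁ - a₂ + a₃}
  InT : {p : Level} → Pred X p → X → Triple → Set (ℓ ⊔ p)
  InT 𝒜 z (a₁ , a₂ , a₃) = 𝒜 a₁ × 𝒜 a₂ × 𝒜 a₃ × (z ≈ ((a₁ − a₂) + a₃))

  AtMostOneInT : {p q : Level} → Pred X p → X → Pred Triple q → Set (c ⊔ ℓ ⊔ p ⊔ q)
  AtMostOneInT 𝒜 z P =
    ∀ t t' → InT 𝒜 z t → InT 𝒜 z t' → P t → P t' → t ≈₃ t'

  Cond1 : X → Triple → Set ℓ
  Cond1 x (a₁ , a₂ , a₃) = x ≈ (a₁ − x)

  Cond2 : X → Triple → Set ℓ
  Cond2 y (a₁ , a₂ , a₃) = y ≈ (a₃ − y)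

  Cond3 : X → X → Triple → Set ℓ
  Cond3 x y (a₁ , a₂ , a₃) = (a₁ − x) ≈ (a₃ − y)

module Submission where

open import Defs
open import Level using (Level)
open import Algebra.Bundles using (AbelianGroup)
open import Data.Product using (∃; _×_; _,_; proj₂)
open import Data.Sum using (_⊎_; inj₁; inj₂)
open import Data.Empty using (⊥-elim)
open import Relation.Nullary using (¬_)
open import Relation.Unary using (Pred)
open import Relation.Binary.Definitions using (_Respects_)

-- Write z = x + y.  A triple (a₁,a₂,a₃) of T(z) satisfies z = a₁ − a₂ + a₃,
-- so it is pinned down as soon as one of a₁, a₃ or a₁ − a₃ is known:
--   * if a₁ is fixed, then a₃ − a₂ = z − a₁ is fixed;
--   * if a₃ is fixed, then a₁ − a₂ = z − a₃ is fixed;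
--   * if a₁ − a₃ is fixed, this difference itself is fixed.
-- In a Sidon set a difference a − b of two elements determines the pair
-- (a,b) unless a = b (the difference form of the Sidon property).  The
-- degenerate alternative a = b means z ∈ 𝒜 in the first two cases and
-- a₁ = a₃ in the third.  Each of the three conditions of the theorem fixes
-- one of these quantities: (1) forces a₁ = 2x, (2) forces a₃ = 2y and (3)
-- forces a₁ − a₃ = x − y; the hypotheses z ∉ 𝒜 and x ≠ y exclude the
-- degenerate alternatives.

module Differences {c ℓ : Level} (G : AbelianGroup c ℓ) where
  open AbelianGroup G renaming (_∙_ to _+_; _⁻¹ to -_)
  open import Algebra.Properties.AbelianGroup G using (∙-cancelˡ; ∙-cancelʳ; ⁻¹-injective)
  open import Relation.Binary.Reasoning.Setoid setoid

  sub-add : ∀ u v w → (u - v) + (v + w) ≈ u + w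
  sub-add u v w = begin
    (u - v) + (v + w)   ≈⟨ assoc u (- v) (v + w) ⟩
    u + (- v + (v + w)) ≈⟨ ∙-congˡ (assoc (- v) v w) ⟨
    u + ((- v + v) + w) ≈⟨ ∙-congˡ (∙-congʳ (inverseˡ v)) ⟩
    u + (ε + w)         ≈⟨ ∙-congˡ (identityˡ w) ⟩
    u + w               ∎

  sub-add-cancel : ∀ u v → (u - v) + v ≈ u
  sub-add-cancel u v = begin
    (u - v) + v        ≈⟨ ∙-congˡ (identityʳ v) ⟨
    (u - v) + (v + ε)  ≈⟨ sub-add u v ε ⟩
    u + ε              ≈⟨ identityʳ u ⟩
    u                  ∎

  self-sub-add : ∀ a c → (a - a) + c ≈ c
  self-sub-add a c = trans (∙-congʳ (inverseʳ a)) (identityˡ c)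

  −≈−⇒+≈+ : ∀ {a b c d} → a - b ≈ c - d → a + d ≈ c + b
  −≈−⇒+≈+ {a} {b} {c} {d} e = begin
    a + d              ≈⟨ sub-add a b d ⟨
    (a - b) + (b + d)  ≈⟨ ∙-cong e (comm b d) ⟩
    (c - d) + (d + b)  ≈⟨ sub-add c d b ⟩
    c + b              ∎

  +≈+⇒−≈− : ∀ {a b c d} → a + d ≈ c + b → a - b ≈ c - d
  +≈+⇒−≈− {a} {b} {c} {d} e = ∙-cancelʳ (b + d) (a - b) (c - d) (begin
    (a - b) + (b + d)  ≈⟨ sub-add a b d ⟩
    a + d              ≈⟨ e ⟩
    c + b              ≈⟨ sub-add c d b ⟨
    (c - d) + (d + b)  ≈⟨ ∙-congˡ (comm d b) ⟩
    (c - d) + (b + d)  ∎)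

  swap-differences : ∀ {a c x y} → a - x ≈ c - y → a - c ≈ x - y
  swap-differences {a} {c} {x} {y} e =
    +≈+⇒−≈− (trans (−≈−⇒+≈+ e) (comm c x))

  sub-add-rearrange : ∀ a b c → (a - b) + c ≈ a + (c - b)
  sub-add-rearrange a b c = begin
    (a - b) + c   ≈⟨ assoc a (- b) c ⟩
    a + (- b + c) ≈⟨ ∙-congˡ (comm (- b) c) ⟩
    a + (c - b)   ∎

  middle-cancel : ∀ {a b b′ c} → (a - b) + c ≈ (a - b′) + c → b ≈ b′
  middle-cancel {a} {b} {b′} {c} e =
    ⁻¹-injective (∙-cancelˡ a (- b) (- b′) (∙-cancelʳ c (a - b) (a - b′) e))

module SidonTriples {c ℓ p : Level} (G : AbelianGroup c ℓ)
  (𝒜 : Pred (AbelianGroup.Carrier G) p) (sidon : IsSidon G 𝒜) where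
  open AbelianGroup G renaming (Carrier to X; _∙_ to _+_)
  open import Algebra.Properties.AbelianGroup G using (∙-cancelˡ; ∙-cancelʳ)
  open Differences G
  open import Relation.Binary.Reasoning.Setoid setoid

  T : X → Triple G → Set _
  T = InT G 𝒜

  _≈₃′_ : Triple G → Triple G → Set ℓ
  _≈₃′_ = _≈₃_ G

  sidon-difference : ∀ {a b c′ d} → 𝒜 a → 𝒜 b → 𝒜 c′ → 𝒜 d →
    a - b ≈ c′ - d → (a ≈ c′ × b ≈ d) ⊎ (a ≈ b)
  sidon-difference A B C D e with proj₂ sidon A D C B (−≈−⇒+≈+ e)
  ... | inj₁ (a≈c′ , d≈b) = inj₁ (a≈c′ , sym d≈b)
  ... | inj₂ (a≈b , _)    = inj₂ a≈b

  outer-determines : ∀ {z a₁ a₂ a₃ b₁ b₂ b₃} →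
    T z (a₁ , a₂ , a₃) → T z (b₁ , b₂ , b₃) → a₁ ≈ b₁ → a₃ ≈ b₃ →
    (a₁ , a₂ , a₃) ≈₃′ (b₁ , b₂ , b₃)
  outer-determines {z} {a₁} {a₂} {a₃} {b₁} {b₂} {b₃} (_ , _ , _ , za) (_ , _ , _ , zb) a₁≈b₁ a₃≈b₃ =
    a₁≈b₁ , middle-cancel same-value , a₃≈b₃
    where
    same-value : (a₁ - a₂) + a₃ ≈ (a₁ - b₂) + a₃
    same-value = begin
      (a₁ - a₂) + a₃  ≈⟨ za ⟨
      z               ≈⟨ zb ⟩
      (b₁ - b₂) + b₃  ≈⟨ ∙-cong (∙-congʳ a₁≈b₁) a₃≈b₃ ⟨
      (a₁ - b₂) + a₃  ∎

  -- If z ∉ 𝒜, a triple of T(z) is determined by its first coordinate: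
  -- a₃ − a₂ = z − a₁ is then fixed, and a₃ = a₂ would give z = a₁ ∈ 𝒜.
  first-determines : 𝒜 Respects _≈_ → ∀ {z a₁ a₂ a₃ b₁ b₂ b₃} → ¬ 𝒜 z →
    T z (a₁ , a₂ , a₃) → T z (b₁ , b₂ , b₃) → a₁ ≈ b₁ →
    (a₁ , a₂ , a₃) ≈₃′ (b₁ , b₂ , b₃)
  first-determines resp {z} {a₁} {a₂} {a₃} {b₁} {b₂} {b₃} z∉𝒜
    ta@(A₁ , A₂ , A₃ , za) tb@(_ , B₂ , B₃ , zb) a₁≈b₁ =
    conclude (sidon-difference A₃ A₂ B₃ B₂ same-tail)
    where
    same-tail : a₃ - a₂ ≈ b₃ - b₂
    same-tail = ∙-cancelˡ a₁ (a₃ - a₂) (b₃ - b₂) (begin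
      a₁ + (a₃ - a₂)  ≈⟨ sub-add-rearrange a₁ a₂ a₃ ⟨
      (a₁ - a₂) + a₃  ≈⟨ trans (sym za) zb ⟩
      (b₁ - b₂) + b₃  ≈⟨ sub-add-rearrange b₁ b₂ b₃ ⟩
      b₁ + (b₃ - b₂)  ≈⟨ ∙-congʳ (sym a₁≈b₁) ⟩
      a₁ + (b₃ - b₂)  ∎)

    conclude : (a₃ ≈ b₃ × a₂ ≈ b₂) ⊎ (a₃ ≈ a₂) → (a₁ , a₂ , a₃) ≈₃′ (b₁ , b₂ , b₃)
    conclude (inj₁ (a₃≈b₃ , _)) = outer-determines ta tb a₁≈b₁ a₃≈b₃
    conclude (inj₂ a₃≈a₂)       = ⊥-elim (z∉𝒜 (resp (begin
      a₁              ≈⟨ sub-add-cancel a₁ a₂ ⟨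
      (a₁ - a₂) + a₂  ≈⟨ ∙-congˡ a₃≈a₂ ⟨
      (a₁ - a₂) + a₃  ≈⟨ za ⟨
      z               ∎) A₁))

  -- If z ∉ 𝒜, a triple of T(z) is determined by its last coordinate:
  -- a₁ − a₂ = z − a₃ is then fixed, and a₁ = a₂ would give z = a₃ ∈ 𝒜.
  third-determines : 𝒜 Respects _≈_ → ∀ {z a₁ a₂ a₃ b₁ b₂ b₃} → ¬ 𝒜 z →
    T z (a₁ , a₂ , a₃) → T z (b₁ , b₂ , b₃) → a₃ ≈ b₃ →
    (a₁ , a₂ , a₃) ≈₃′ (b₁ , b₂ , b₃)
  third-determines resp {z} {a₁} {a₂} {a₃} {b₁} {b₂} {b₃} z∉𝒜
    ta@(A₁ , A₂ , A₃ , za) tb@(B₁ , B₂ , _ , zb) a₃≈b₃ =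
    conclude (sidon-difference A₁ A₂ B₁ B₂ same-head)
    where
    same-head : a₁ - a₂ ≈ b₁ - b₂
    same-head = ∙-cancelʳ a₃ (a₁ - a₂) (b₁ - b₂) (begin
      (a₁ - a₂) + a₃  ≈⟨ trans (sym za) zb ⟩
      (b₁ - b₂) + b₃  ≈⟨ ∙-congˡ a₃≈b₃ ⟨
      (b₁ - b₂) + a₃  ∎)

    conclude : (a₁ ≈ b₁ × a₂ ≈ b₂) ⊎ (a₁ ≈ a₂) → (a₁ , a₂ , a₃) ≈₃′ (b₁ , b₂ , b₃)
    conclude (inj₁ (a₁≈b₁ , _)) = outer-determines ta tb a₁≈b₁ a₃≈b₃
    conclude (inj₂ a₁≈a₂)       = ⊥-elim (z∉𝒜 (resp (begin
      a₃              ≈⟨ self-sub-add a₂ a₃ ⟨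
      (a₂ - a₂) + a₃  ≈⟨ ∙-congʳ (∙-congʳ a₁≈a₂) ⟨
      (a₁ - a₂) + a₃  ≈⟨ za ⟨
      z               ∎) A₃))

  outer-difference-determines : ∀ {z a₁ a₂ a₃ b₁ b₂ b₃} →
    T z (a₁ , a₂ , a₃) → T z (b₁ , b₂ , b₃) → a₁ - a₃ ≈ b₁ - b₃ → ¬ a₁ ≈ a₃ →
    (a₁ , a₂ , a₃) ≈₃′ (b₁ , b₂ , b₃)
  outer-difference-determines ta@(A₁ , _ , A₃ , _) tb@(B₁ , _ , B₃ , _) e a₁≉a₃
    with sidon-difference A₁ A₃ B₁ B₃ e
  ... | inj₁ (a₁≈b₁ , a₃≈b₃) = outer-determines ta tb a₁≈b₁ a₃≈b₃
  ... | inj₂ a₁≈a₃           = ⊥-elim (a₁≉a₃ a₁≈a₃)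

module ThreeConditions {c ℓ p : Level} (G : AbelianGroup c ℓ)
  (𝒜 : Pred (AbelianGroup.Carrier G) p) (resp : 𝒜 Respects AbelianGroup._≈_ G)
  (sidon : IsSidon G 𝒜) (x y : AbelianGroup.Carrier G)
  (x≉y : ¬ AbelianGroup._≈_ G x y) (x+y∉𝒜 : ¬ 𝒜 (AbelianGroup._∙_ G x y)) where
  open AbelianGroup G renaming (_∙_ to _+_; _⁻¹ to -_)
  open import Algebra.Properties.AbelianGroup G using (∙-cancelʳ; x∙y⁻¹≈ε⇒x≈y; x≈y⇒x∙y⁻¹≈ε)
  open Differences G using (swap-differences)
  open SidonTriples G 𝒜 sidon

  condition₁ : AtMostOneInT G 𝒜 (x + y) (Cond1 G x)
  condition₁ (a₁ , _ , _) (b₁ , _ , _) ta tb x≈a₁-x x≈b₁-x =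
    first-determines resp x+y∉𝒜 ta tb (∙-cancelʳ (- x) a₁ b₁ (trans (sym x≈a₁-x) x≈b₁-x))

  condition₂ : AtMostOneInT G 𝒜 (x + y) (Cond2 G y)
  condition₂ (_ , _ , a₃) (_ , _ , b₃) ta tb y≈a₃-y y≈b₃-y =
    third-determines resp x+y∉𝒜 ta tb (∙-cancelʳ (- y) a₃ b₃ (trans (sym y≈a₃-y) y≈b₃-y))

  -- (3): a₁ − x = a₃ − y means a₁ − a₃ = x − y, which is nontrivial as x ≠ y
  condition₃ : AtMostOneInT G 𝒜 (x + y) (Cond3 G x y)
  condition₃ (a₁ , _ , a₃) (b₁ , _ , b₃) ta tb ca cb =
    outer-difference-determines ta tb (trans da (sym (swap-differences cb))) a₁≉a₃
    where
    da : a₁ - a₃ ≈ x - y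
    da = swap-differences ca

    a₁≉a₃ : ¬ a₁ ≈ a₃
    a₁≉a₃ a₁≈a₃ = x≉y (x∙y⁻¹≈ε⇒x≈y x y (trans (sym da) (x≈y⇒x∙y⁻¹≈ε a₁≈a₃)))

open AbelianGroup using (Carrier; _≈_; _∙_)

mainTheorem3 : {c ℓ p : Level} (G : AbelianGroup c ℓ) →
    (𝒜 : Pred (Carrier G) p) → 𝒜 Respects (_≈_ G) → IsSidon G 𝒜 →
    (x y : Carrier G) → ¬ (_≈_ G x y) → ¬ 𝒜 (_∙_ G x y) →
    (∃ λ t → InT G 𝒜 (_∙_ G x y) t) →
    AtMostOneInT G 𝒜 (_∙_ G x y) (Cond1 G x)
      × AtMostOneInT G 𝒜 (_∙_ G x y) (Cond2 G y)
      × AtMostOneInT G 𝒜 (_∙_ G x y) (Cond3 G x y)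
mainTheorem3 G 𝒜 resp sidon x y x≉y x+y∉𝒜 _ =
  condition₁ , condition₂ , condition₃
  where open ThreeConditions G 𝒜 resp sidon x y x≉y x+y∉𝒜
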